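{- Let $H$ be an $r$-partite intersecting hypergraph and let $V_1$ be one of its sides. Suppose that $V_1$ contains $y_1$ vertices of degree $1$ and $y_2$ vertices of degree at least $2$. Then $(y_1+1)/2+y_2\ge\tau(H)$.
   Context: A hypergraph is $r$-partite if its vertex set can be partitioned into $r$ sets $V_1,\dots,V_r$ (the sides) so that every edge contains exactly one vertex from each side. $H$ is intersecting if every two edges share a vertex. The covering number $\tau(H)$ is the minimum size of a set of vertices meeting every edge. -}

module Defs where

open import Data.Nat using (ℕ; _≤_; _+_; _*_)
open import Data.Fin using (Fin)
open import Data.Fin.Properties using (_≟_)
open import Data.List using (List; length; filter; allFin)
open import Data.List.Membership.Propositional using (_∈_)
open import Data.Product using (Σ; ∃; ∃-syntax; _×_; _,_)
open import Relation.Binary.PropositionalEquality using (_≡_)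
open import Relation.Nullary using (¬_)
open import Data.Nat.Properties using (_≤?_)

-- An edge contains exactly one vertex from each side, so it is a choice
-- function picking the vertex e i of side i.  Edges are kept in a list
-- (repeated edges allowed, i.e. multi-hypergraphs; simple ones are a special case).
record RPartite (r : ℕ) : Set where
  field
    sz    : Fin r → ℕ
    edges : List ((i : Fin r) → Fin (sz i))

open RPartite public

Edge : ∀ {r} → RPartite r → Set
Edge H = (i : _) → Fin (sz H i)

Vertex : ∀ {r} → RPartite r → Set
Vertex {r} H = Σ (Fin r) (λ i → Fin (sz H i))

_∈ₑ_ : ∀ {r} {H : RPartite r} → Vertex H → Edge H → Set
_∈ₑ_ (i , v) e = e i ≡ v

Intersecting : ∀ {r} → RPartite r → Set
Intersecting H = ∀ {e f} → e ∈ edges H → f ∈ edges H → ∃[ i ] (e i ≡ f i)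

degree : ∀ {r} (H : RPartite r) (i : Fin r) → Fin (sz H i) → ℕ
degree H i v = length (filter (λ e → e i ≟ v) (edges H))

countDeg1 : ∀ {r} (H : RPartite r) (i : Fin r) → ℕ
countDeg1 H i = length (filter (λ v → degree H i v Data.Nat.≟ 1) (allFin (sz H i)))

countDeg≥2 : ∀ {r} (H : RPartite r) (i : Fin r) → ℕ
countDeg≥2 H i = length (filter (λ v → 2 ≤? degree H i v) (allFin (sz H i)))

IsCover : ∀ {r} (H : RPartite r) → List (Vertex H) → Set
IsCover H C = ∀ {e} → e ∈ edges H → ∃[ x ] (x ∈ C × _∈ₑ_ {H = H} x e)

IsCoveringNumber : ∀ {r} (H : RPartite r) → ℕ → Set
IsCoveringNumber H t =
  (∃[ C ] (IsCover H C × length C ≡ t)) × (∀ C → IsCover H C → t ≤ length C)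

module Submission where

-- Two edges of an intersecting hypergraph share a vertex, so
-- any list of m edges can be covered by ⌈m/2⌉ vertices: pair the edges up
-- and take one common vertex per pair (and any vertex of a leftover edge).
-- Now fix a side V_j.  Every edge e meets V_j in the vertex e j, whose
-- degree is 1 or at least 2.  The edges whose V_j-vertex has degree 1 are
-- exactly one per degree-1 vertex, so there are y₁ of them, and pairing
-- covers them with at most (y₁ + 1)/2 vertices; all remaining edges are
-- covered by the y₂ vertices of V_j of degree at least 2.  This gives a
-- cover C with 2·|C| ≤ y₁ + 1 + 2·y₂, and minimality of τ gives the bound.

open import Defs
open import Data.Nat using (ℕ; _≤_; _+_; _*_; suc; z≤n; s≤s)
open import Data.Nat.Properties
  using (_≤?_; ≤-trans; ≤-reflexive; +-mono-≤; +-monoʳ-≤; *-monoʳ-≤; *-suc; *-distribˡ-+; m≤n⇒m<n∨m≡n; module ≤-Reasoning)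
import Data.Nat as ℕ
open import Data.Fin using (Fin)
open import Data.Fin.Properties using (_≟_)
open import Data.List using (List; []; _∷_; _++_; length; filter; allFin; map)
open import Data.List.Properties using (length-++; length-map)
open import Data.List.Membership.Propositional using (_∈_)
open import Data.List.Membership.Propositional.Properties
  using (∈-filter⁺; ∈-filter⁻; ∈-++⁺ˡ; ∈-++⁺ʳ; ∈-++⁻; ∈-map⁺; ∈-allFin; ∈-length)
open import Data.List.Relation.Binary.Subset.Propositional using (_⊆_)
open import Data.List.Relation.Unary.All using (All; []; _∷_)
open import Data.List.Relation.Unary.All.Properties using (all-filter)
open import Data.List.Relation.Unary.Any using (here; there)
open import Data.Product using (Σ-syntax; ∃-syntax; _×_; _,_; proj₁; proj₂)
open import Data.Sum using (inj₁; inj₂)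
open import Relation.Binary.PropositionalEquality using (_≡_; refl; sym; trans; cong; cong₂)

Covers : ∀ {r} (H : RPartite r) → List (Vertex H) → List (Edge H) → Set
Covers H C Es = ∀ {e} → e ∈ Es → ∃[ x ] (x ∈ C × _∈ₑ_ {H = H} x e)

module _ {r} {H : RPartite r} (inter : Intersecting H) where

  -- Pairing: in an intersecting hypergraph any m edges are covered by
  -- ⌈m/2⌉ vertices, one common vertex for each pair of consecutive edges.
  pairingCover : (Es : List (Edge H)) → Es ⊆ edges H →
    Σ[ C ∈ List (Vertex H) ] (Covers H C Es × 2 * length C ≤ length Es + 1)
  pairingCover [] _ = [] , (λ ()) , z≤n
  -- a lone edge meets itself, which exhibits a side i to take its vertex from
  pairingCover (e ∷ []) Es⊆H with inter (Es⊆H (here refl)) (Es⊆H (here refl))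
  ... | i , _ = ((i , e i) ∷ []) , (λ { (here refl) → _ , here refl , refl }) , s≤s (s≤s z≤n)
  pairingCover (e ∷ f ∷ Es) Es⊆H
    with inter (Es⊆H (here refl)) (Es⊆H (there (here refl)))
       | pairingCover Es (λ m → Es⊆H (there (there m)))
  ... | i , eᵢ≡fᵢ | C , covers , size = (x ∷ C) , covers′ , size′
    where
      x : Vertex H
      x = i , e i

      covers′ : Covers H (x ∷ C) (e ∷ f ∷ Es)
      covers′ (here refl)         = x , here refl , refl
      covers′ (there (here refl)) = x , here refl , sym eᵢ≡fᵢ
      covers′ (there (there m)) with covers m
      ... | y , y∈C , y∈e = y , there y∈C , y∈e

      size′ : 2 * suc (length C) ≤ suc (suc (length Es)) + 1
      size′ = ≤-trans (≤-reflexive (*-suc 2 (length C))) (+-monoʳ-≤ 2 size)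

module _ {r} (H : RPartite r) (j : Fin r) where

  edgesAt : Fin (sz H j) → List (Edge H)
  edgesAt v = filter (λ e → e j ≟ v) (edges H)

  onSide : Fin (sz H j) → Vertex H
  onSide v = j , v

  degree-pos : ∀ {e} → e ∈ edges H → 1 ≤ degree H j (e j)
  degree-pos e∈H = ∈-length (∈-filter⁺ (λ f → f j ≟ _) e∈H refl)

  edgesThrough : List (Fin (sz H j)) → List (Edge H)
  edgesThrough []       = []
  edgesThrough (v ∷ vs) = edgesAt v ++ edgesThrough vs

  edgesThrough-⊆ : ∀ vs → edgesThrough vs ⊆ edges H
  edgesThrough-⊆ (v ∷ vs) e∈ with ∈-++⁻ (edgesAt v) e∈
  ... | inj₁ e∈v  = proj₁ (∈-filter⁻ (λ f → f j ≟ v) e∈v)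
  ... | inj₂ e∈vs = edgesThrough-⊆ vs e∈vs

  edgesThrough-∋ : ∀ vs {e} → e j ∈ vs → e ∈ edges H → e ∈ edgesThrough vs
  edgesThrough-∋ (v ∷ vs) (here refl) e∈H = ∈-++⁺ˡ (∈-filter⁺ (λ f → f j ≟ v) e∈H refl)
  edgesThrough-∋ (v ∷ vs) (there ej∈vs) e∈H = ∈-++⁺ʳ (edgesAt v) (edgesThrough-∋ vs ej∈vs e∈H)

  length-edgesThrough : ∀ vs → All (λ v → degree H j v ≡ 1) vs →
    length (edgesThrough vs) ≡ length vs
  length-edgesThrough []       []         = refl
  length-edgesThrough (v ∷ vs) (d≡1 ∷ ds) =
    trans (length-++ (edgesAt v)) (cong₂ _+_ d≡1 (length-edgesThrough vs ds))

  degreeOne degreeTwoPlus : List (Fin (sz H j))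
  degreeOne     = filter (λ v → degree H j v ℕ.≟ 1) (allFin (sz H j))
  degreeTwoPlus = filter (λ v → 2 ≤? degree H j v) (allFin (sz H j))

  module _ (inter : Intersecting H) where

    pairedPart : Σ[ C ∈ List (Vertex H) ]
      (Covers H C (edgesThrough degreeOne) ×
       2 * length C ≤ length (edgesThrough degreeOne) + 1)
    pairedPart = pairingCover inter (edgesThrough degreeOne) (edgesThrough-⊆ degreeOne)

    sideCover : List (Vertex H)
    sideCover = proj₁ pairedPart ++ map onSide degreeTwoPlus

    -- an edge e is covered by (j , e j) if that vertex has degree ≥ 2, and
    -- otherwise e passes through a degree-1 vertex, hence by the paired part
    sideCover-covers : IsCover H sideCover
    sideCover-covers {e} e∈H with m≤n⇒m<n∨m≡n (degree-pos e∈H)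
    ... | inj₁ two≤deg =
      (j , e j) , ∈-++⁺ʳ (proj₁ pairedPart)
        (∈-map⁺ onSide (∈-filter⁺ (λ v → 2 ≤? degree H j v) (∈-allFin (e j)) two≤deg)) , refl
    ... | inj₂ one≡deg with proj₁ (proj₂ pairedPart)
        (edgesThrough-∋ degreeOne
          (∈-filter⁺ (λ v → degree H j v ℕ.≟ 1) (∈-allFin (e j)) (sym one≡deg)) e∈H)
    ...   | x , x∈C , x∈e = x , ∈-++⁺ˡ x∈C , x∈e

    -- |paired part| ≤ (y₁ + 1)/2 since there are y₁ edges through degree-1 vertices
    sideCover-size : 2 * length sideCover ≤ countDeg1 H j + 1 + 2 * countDeg≥2 H j
    sideCover-size = begin
      2 * length sideCover
        ≡⟨ cong (2 *_) (length-++ C) ⟩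
      2 * (length C + length (map onSide degreeTwoPlus))
        ≡⟨ *-distribˡ-+ 2 (length C) _ ⟩
      2 * length C + 2 * length (map onSide degreeTwoPlus)
        ≤⟨ +-mono-≤ (proj₂ (proj₂ pairedPart))
                    (≤-reflexive (cong (2 *_) (length-map onSide degreeTwoPlus))) ⟩
      length (edgesThrough degreeOne) + 1 + 2 * countDeg≥2 H j
        ≡⟨ cong (λ k → k + 1 + 2 * countDeg≥2 H j)
                (length-edgesThrough degreeOne (all-filter (λ v → degree H j v ℕ.≟ 1) (allFin (sz H j)))) ⟩
      countDeg1 H j + 1 + 2 * countDeg≥2 H j ∎
      where
        open ≤-Reasoning
        C = proj₁ pairedPart

lemma5 : ∀ {r} (H : RPartite r) (j : Fin r) (τ : ℕ) →
    Intersecting H → IsCoveringNumber H τ →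
    2 * τ ≤ countDeg1 H j + 1 + 2 * countDeg≥2 H j
lemma5 H j τ inter (_ , minimal) =
  ≤-trans (*-monoʳ-≤ 2 (minimal (sideCover H j inter) (sideCover-covers H j inter)))
          (sideCover-size H j inter)
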